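{- Let $G$ be a finite graph of order $n$ and let $G/\mathcal{R}$ be the maximal twin-free subgraph of $G$. Then $$\log_2 \omega(G/\mathcal{R})+1\leq \chi_{rlid}(G)\leq n.$$
   Context: For a vertex $x$, $N[x]$ is its closed neighborhood. Distinct vertices $u,v$ are twins if $N[u]=N[v]$; $G/\mathcal{R}$ is the induced subgraph of $G$ obtained by keeping exactly one vertex from each class of the equivalence relation $N[u]=N[v]$. $\omega(H)$ denotes the maximum size of a clique of $H$. An $rlid$-coloring of a graph $H$ is a map $c:V(H)\to\mathbb{N}$ (not necessarily proper) such that for every pair of adjacent vertices $u,v$ with $N[u]\neq N[v]$ we have $c(N[u])\neq c(N[v])$, where $c(X)=\{c(x):x\in X\}$; $\chi_{rlid}(H)$ is the minimum number of colors in an $rlid$-coloring of $H$. The logarithm is base $2$. -}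

module Defs where

open import Level using (0ℓ)
open import Data.Nat using (ℕ; _≤_)
open import Data.Fin using (Fin; toℕ) renaming (_<_ to _<ᶠ_)
open import Data.Product using (Σ; ∃; _×_; _,_)
open import Data.Sum using (_⊎_)
open import Relation.Nullary using (¬_; Dec)
open import Relation.Binary.PropositionalEquality using (_≡_; _≢_)
open import Function.Bundles using (_⇔_)

record Graph (n : ℕ) : Set₁ where
  field
    Adj    : Fin n → Fin n → Set
    sym    : ∀ {u v} → Adj u v → Adj v u
    irrefl : ∀ {u} → ¬ Adj u u
    dec    : ∀ u v → Dec (Adj u v)
open Graph public

module _ {n : ℕ} (G : Graph n) where

  InN : Fin n → Fin n → Set
  InN u x = (x ≡ u) ⊎ Adj G u x

  SameN : Fin n → Fin n → Set
  SameN u v = ∀ x → InN u x ⇔ InN v x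

  Twins : Fin n → Fin n → Set
  Twins u v = (u ≢ v) × SameN u v

  -- G/R keeps one vertex per twin class; we keep the vertex of least index.
  Rep : Fin n → Set
  Rep u = ∀ v → v <ᶠ u → ¬ SameN u v

  CliqueIn : (Fin n → Set) → ℕ → Set
  CliqueIn P m = Σ (Fin m → Fin n) λ K →
    (∀ i → P (K i)) × (∀ i j → i ≢ j → Adj G (K i) (K j))

  IsCliqueNumberIn : (Fin n → Set) → ℕ → Set
  IsCliqueNumberIn P m = CliqueIn P m × (∀ j → CliqueIn P j → j ≤ m)

  IsCliqueNumberQuot : ℕ → Set
  IsCliqueNumberQuot = IsCliqueNumberIn Rep

  InColN : ∀ {k} → (Fin n → Fin k) → Fin n → Fin k → Set
  InColN c u i = ∃ λ x → InN u x × (c x ≡ i)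

  SameColN : ∀ {k} → (Fin n → Fin k) → Fin n → Fin n → Set
  SameColN c u v = ∀ i → InColN c u i ⇔ InColN c v i

  -- rlid-colouring using (at most) k colours
  IsRlid : ∀ {k} → (Fin n → Fin k) → Set
  IsRlid c = ∀ u v → Adj G u v → ¬ SameN u v → ¬ SameColN c u v

  HasRlid : ℕ → Set
  HasRlid k = Σ (Fin n → Fin k) IsRlid

  IsChiRlid : ℕ → Set
  IsChiRlid k = HasRlid k × (∀ j → HasRlid j → k ≤ j)

-- Upper bound: the identity colouring is an rlid-colouring, since c(N[u]) = N[u]
-- for it.  Lower bound: on a clique K of pairwise non-twin vertices an
-- rlid-colouring c makes the colour sets c(N[u]), u ∈ K, pairwise distinct, and
-- all of them contain the colour of one fixed clique vertex.  These sets together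
-- with their complements are 2ω distinct subsets of the χ colours.
module Submission where

open import Defs
open import Data.Nat using (ℕ; _≤_; _*_; _^_)
open import Data.Product using (∃; _×_)

open import Level using (Level)
open import Data.Nat using (zero; suc; _+_; z≤n; s≤s)
open import Data.Nat.Properties using (+-identityʳ)
open import Data.Fin as Fin using (Fin; finToFun; funToFin; splitAt; join)
open import Data.Fin.Properties
  using (_≟_; <-cmp; any?; all?; injective⇒≤; 2↔Bool; finToFun-funToFin; join-splitAt)
open import Data.Bool using (Bool; true; not)
open import Data.Bool.Properties using (not-injective; not-¬)
open import Data.Product using (_,_; proj₁)
open import Data.Sum using (_⊎_; inj₁; inj₂)
open import Data.Empty using (⊥-elim)
open import Function using (_∘_; id)
open import Function.Bundles using (_⇔_; mk⇔; Inverse; Equivalence)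
open import Relation.Binary using (tri<; tri≈; tri>)
open import Relation.Binary.PropositionalEquality as ≡
  using (_≡_; _≗_; refl; trans; cong; subst)
open import Relation.Nullary using (¬_; Dec; yes; no; does; ¬?)
open import Relation.Nullary.Decidable using (_×-dec_; _⊎-dec_; _→-dec_; map′)
open import Relation.Unary using (Pred; Decidable)

open Equivalence using (to; from)

private
  variable
    p : Level
    A B : Set

leastWitness : {P : Pred ℕ p} → Decidable P → ∀ m → P m →
               ∃ λ k → P k × k ≤ m × (∀ j → P j → k ≤ j)
leastWitness P? zero    Pm = zero , Pm , z≤n , λ _ _ → z≤n
leastWitness P? (suc m) Pm with P? zero
... | yes P0 = zero , P0 , z≤n , λ _ _ → z≤n
... | no ¬P0 with leastWitness (P? ∘ suc) m Pm
...   | k , Pk , k≤m , minimal = suc k , Pk , s≤s k≤m , λ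
  { zero    P0  → ⊥-elim (¬P0 P0)
  ; (suc j) Psj → s≤s (minimal j Psj) }

_⇔?_ : Dec A → Dec B → Dec (A ⇔ B)
a? ⇔? b? = map′ (λ (f , g) → mk⇔ f g) (λ e → to e , from e) ((a? →-dec b?) ×-dec (b? →-dec a?))

does-≡⇒→ : (a? : Dec A) (b? : Dec B) → does a? ≡ does b? → A → B
does-≡⇒→ (yes _) (yes b) _  _ = b
does-≡⇒→ (no ¬a) _       _  a = ⊥-elim (¬a a)

boolFunctions-injection⇒≤ : ∀ {m k} (S : Fin m → Fin k → Bool) →
                            (∀ i j → S i ≗ S j → i ≡ j) → m ≤ 2 ^ k
boolFunctions-injection⇒≤ {m} {k} S S-inj = injective⇒≤ {f = code} (S-inj _ _ ∘ decode-≗)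
  where
  open Inverse 2↔Bool using (strictlyInverseˡ) renaming (to to toBool; from to fromBool)
  code : Fin m → Fin (2 ^ k)
  code i = funToFin (fromBool ∘ S i)
  decode-≗ : ∀ {i j} → code i ≡ code j → S i ≗ S j
  decode-≗ {i} {j} eq x = begin
    S i x                                ≡⟨ strictlyInverseˡ (S i x) ⟨
    toBool (fromBool (S i x))            ≡⟨ cong toBool (finToFun-funToFin (fromBool ∘ S i) x) ⟨
    toBool (finToFun (code i) x)         ≡⟨ cong (λ y → toBool (finToFun y x)) eq ⟩
    toBool (finToFun (code j) x)         ≡⟨ cong toBool (finToFun-funToFin (fromBool ∘ S j) x) ⟩
    toBool (fromBool (S j x))            ≡⟨ strictlyInverseˡ (S j x) ⟩
    S j x                                ∎
    where open ≡.≡-Reasoning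

-- Complements of sets sharing the point q cannot contain q, so they differ
-- from all the original sets.
commonPoint⇒double≤ : ∀ {m k} (S : Fin m → Fin k → Bool) →
                      (∀ i j → S i ≗ S j → i ≡ j) →
                      (q : Fin k) → (∀ i → S i q ≡ true) → 2 * m ≤ 2 ^ k
commonPoint⇒double≤ {m} {k} S S-inj q S∋q =
  subst (_≤ 2 ^ k) (cong (m +_) (≡.sym (+-identityʳ m)))
    (boolFunctions-injection⇒≤ (withComplements ∘ splitAt m) injective)
  where
  withComplements : Fin m ⊎ Fin m → Fin k → Bool
  withComplements (inj₁ i) = S i
  withComplements (inj₂ i) = not ∘ S i
  withComplements-injective : ∀ a b → withComplements a ≗ withComplements b → a ≡ b
  withComplements-injective (inj₁ i) (inj₁ j) eq = cong inj₁ (S-inj i j eq)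
  withComplements-injective (inj₂ i) (inj₂ j) eq = cong inj₂ (S-inj i j (not-injective ∘ eq))
  withComplements-injective (inj₁ i) (inj₂ j) eq = ⊥-elim (not-¬ (trans (S∋q i) (≡.sym (S∋q j))) (eq q))
  withComplements-injective (inj₂ i) (inj₁ j) eq = ⊥-elim (not-¬ (trans (S∋q j) (≡.sym (S∋q i))) (≡.sym (eq q)))
  injective : ∀ a b → withComplements (splitAt m a) ≗ withComplements (splitAt m b) → a ≡ b
  injective a b eq = trans (≡.sym (join-splitAt m m a))
    (trans (cong (join m m) (withComplements-injective (splitAt m a) (splitAt m b) eq)) (join-splitAt m m b))

module _ {n : ℕ} (G : Graph n) where

  InN? : ∀ u x → Dec (InN G u x)
  InN? u x = (x ≟ u) ⊎-dec dec G u x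

  SameN? : ∀ u v → Dec (SameN G u v)
  SameN? u v = all? λ x → InN? u x ⇔? InN? v x

  InColN? : ∀ {k} (c : Fin n → Fin k) u i → Dec (InColN G c u i)
  InColN? c u i = any? λ x → InN? u x ×-dec (c x ≟ i)

  SameColN? : ∀ {k} (c : Fin n → Fin k) u v → Dec (SameColN G c u v)
  SameColN? c u v = all? λ i → InColN? c u i ⇔? InColN? c v i

  IsRlid? : ∀ {k} (c : Fin n → Fin k) → Dec (IsRlid G c)
  IsRlid? c = all? λ u → all? λ v →
    dec G u v →-dec (¬? (SameN? u v) →-dec ¬? (SameColN? c u v))

  InColN-resp-≗ : ∀ {k} {c c′ : Fin n → Fin k} → c ≗ c′ → ∀ u i → InColN G c u i → InColN G c′ u i
  InColN-resp-≗ c≗c′ u i (x , x∈N[u] , cx≡i) = x , x∈N[u] , trans (≡.sym (c≗c′ x)) cx≡i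

  IsRlid-resp-≗ : ∀ {k} {c c′ : Fin n → Fin k} → c ≗ c′ → IsRlid G c → IsRlid G c′
  IsRlid-resp-≗ {c = c} {c′} c≗c′ rlid u v u~v ¬same same′ = rlid u v u~v ¬same λ i → mk⇔
    (back v i ∘ to (same′ i) ∘ InColN-resp-≗ c≗c′ u i)
    (back u i ∘ from (same′ i) ∘ InColN-resp-≗ c≗c′ v i)
    where
    back : ∀ w i → InColN G c′ w i → InColN G c w i
    back = InColN-resp-≗ (≡.sym ∘ c≗c′)

  -- Colourings Fin n → Fin k are enumerated as Fin (k ^ n).
  HasRlid? : ∀ k → Dec (HasRlid G k)
  HasRlid? k = map′ (λ (i , rlid) → finToFun i , rlid)
    (λ (c , rlid) → funToFin c , IsRlid-resp-≗ (≡.sym ∘ finToFun-funToFin c) rlid)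
    (any? (IsRlid? ∘ finToFun))

  id-isRlid : IsRlid G id
  id-isRlid u v u~v ¬same same = ¬same λ x → mk⇔
    (λ x∈N[u] → let (_ , y∈N[v] , y≡x) = to   (same x) (x , x∈N[u] , refl) in subst (InN G v) y≡x y∈N[v])
    (λ x∈N[v] → let (_ , y∈N[u] , y≡x) = from (same x) (x , x∈N[v] , refl) in subst (InN G u) y≡x y∈N[u])

  Rep-SameN⇒≡ : ∀ {u v} → Rep G u → Rep G v → SameN G u v → u ≡ v
  Rep-SameN⇒≡ {u} {v} rep-u rep-v same with <-cmp u v
  ... | tri< u<v _ _ = ⊥-elim (rep-v u u<v λ x → mk⇔ (from (same x)) (to (same x)))
  ... | tri≈ _ u≡v _ = u≡v
  ... | tri> _ _ v<u = ⊥-elim (rep-u v v<u same)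

  colourSet : ∀ {k} → (Fin n → Fin k) → Fin n → Fin k → Bool
  colourSet c u i = does (InColN? c u i)

  colourSet-≗⇒SameColN : ∀ {k} (c : Fin n → Fin k) {u v} → colourSet c u ≗ colourSet c v → SameColN G c u v
  colourSet-≗⇒SameColN c {u} {v} eq i = mk⇔
    (does-≡⇒→ (InColN? c u i) (InColN? c v i) (eq i))
    (does-≡⇒→ (InColN? c v i) (InColN? c u i) (≡.sym (eq i)))

  rlid⇒double-clique≤ : ∀ {k ω} {c : Fin n → Fin k} → IsRlid G c → CliqueIn G (Rep G) ω → 2 * ω ≤ 2 ^ k
  rlid⇒double-clique≤ {ω = zero}  _    _ = z≤n
  rlid⇒double-clique≤ {ω = suc _} {c} rlid (K , rep , adj) =
    commonPoint⇒double≤ (colourSet c ∘ K) colourSet-injective (c (K Fin.zero)) colourSet∋c₀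
    where
    colourSet∋c₀ : ∀ i → colourSet c (K i) (c (K Fin.zero)) ≡ true
    colourSet∋c₀ i with InColN? c (K i) (c (K Fin.zero)) | i ≟ Fin.zero
    ... | yes _    | _        = refl
    ... | no ¬c₀∈  | yes refl = ⊥-elim (¬c₀∈ (K Fin.zero , inj₁ refl , refl))
    ... | no ¬c₀∈  | no i≢0   = ⊥-elim (¬c₀∈ (K Fin.zero , inj₂ (adj i Fin.zero i≢0) , refl))
    colourSet-injective : ∀ i j → colourSet c (K i) ≗ colourSet c (K j) → i ≡ j
    colourSet-injective i j eq with i ≟ j
    ... | yes i≡j = i≡j
    ... | no  i≢j = ⊥-elim (rlid (K i) (K j) (adj i j i≢j) ¬same (colourSet-≗⇒SameColN c eq))
      where
      ¬same : ¬ SameN G (K i) (K j)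
      ¬same same = G .irrefl (subst (Adj G (K i)) (≡.sym (Rep-SameN⇒≡ (rep i) (rep j) same)) (adj i j i≢j))

mainTheorem2 : ∀ (n : ℕ) (G : Graph n) →
    ∃ λ χ → IsChiRlid G χ × χ ≤ n ×
    (∀ ω → IsCliqueNumberQuot G ω → 2 * ω ≤ 2 ^ χ)
mainTheorem2 n G with leastWitness (HasRlid? G) n (id , id-isRlid G)
... | χ , (c , rlid) , χ≤n , minimal =
  χ , ((c , rlid) , minimal) , χ≤n , λ ω isω → rlid⇒double-clique≤ G rlid (proj₁ isω)
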